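{- Let $t$ be a term of the CBN calculus $\lambda_{\mathtt{n}}$. Then $t$ is $\lambda_{\mathtt{n}}$-meaningful if and only if its CBN embedding $t^{\mathtt{n}}$ is $\lambda_{!}$-meaningful.
   Context: The distant bang calculus $\lambda_{!}$ has terms $t,u,s ::= x \mid tu \mid \lambda x.t \mid !t \mid \mathrm{der}(t) \mid t[x\backslash u]$ (where $t[x\backslash u]$ is an explicit substitution). List contexts are $L ::= \square \mid L[x\backslash t]$; surface contexts are $S ::= \square \mid St \mid tS \mid \lambda x.S \mid \mathrm{der}(S) \mid S[x\backslash t] \mid t[x\backslash S]$ (no hole under $!$). The rewrite rules are $L\langle\lambda x.t\rangle u \mapsto L\langle t[x\backslash u]\rangle$, $t[x\backslash L\langle !u\rangle] \mapsto L\langle t\{x:=u\}\rangle$, and $\mathrm{der}(L\langle !t\rangle) \mapsto L\langle t\rangle$; surface reduction $\to_S$ is their closure under surface contexts, and $\to_S^*$ its reflexive-transitive closure. A term $t$ is $\lambda_{!}$-meaningful if there are a testing context $T ::= \square \mid Ts \mid (\lambda x.T)s$ and a term $u$ such that $T\langle t\rangle \to_S^* !u$. The CBN calculus $\lambda_{\mathtt{n}}$ has terms $t,u ::= x \mid \lambda x.t \mid tu \mid t[x\backslash u]$, list contexts $L ::= \square \mid L[x\backslash t]$ and CBN surface contexts $N ::= \square \mid Nt \mid \lambda x.N \mid N[x\backslash t]$; its surface reduction $\to_{\mathtt{n}}$ is the closure under CBN surface contexts of the rules $L\langle\lambda x.t\rangle u \mapsto L\langle t[x\backslash u]\rangle$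 and $t[x\backslash u]\mapsto t\{x:=u\}$. A term $t$ is $\lambda_{\mathtt{n}}$-meaningful if there is a testing context $T ::= \square \mid Tu \mid (\lambda x.T)u$ such that $T\langle t\rangle \to_{\mathtt{n}}^* \lambda z.z$. The CBN embedding into $\lambda_{!}$ is defined by $x^{\mathtt{n}} = x$, $(\lambda x.t)^{\mathtt{n}} = \lambda x.t^{\mathtt{n}}$, $(tu)^{\mathtt{n}} = t^{\mathtt{n}}\,!u^{\mathtt{n}}$, $(t[x\backslash u])^{\mathtt{n}} = t^{\mathtt{n}}[x\backslash !u^{\mathtt{n}}]$. -}

module Defs where

-- Terms are represented with de Bruijn indices (so alpha-equivalence is
-- syntactic equality and meta-level substitution is capture-avoiding).
-- A binder (lambda, or the variable bound by an explicit substitution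
-- t[x\u], which binds in t only) binds index 0.

open import Data.Nat using (ℕ; zero; suc; _+_)
open import Data.Product using (∃; ∃-syntax; _×_; _,_)
open import Relation.Binary.Construct.Closure.ReflexiveTransitive using (Star)

data Tm! : Set where
  var : ℕ → Tm!
  app : Tm! → Tm! → Tm!
  lam : Tm! → Tm!
  bang : Tm! → Tm!
  der : Tm! → Tm!
  es  : Tm! → Tm! → Tm!        -- es t u = t[x\u]  (x = index 0 in t)

ext : (ℕ → ℕ) → ℕ → ℕ
ext ρ zero = zero
ext ρ (suc n) = suc (ρ n)

ren! : (ℕ → ℕ) → Tm! → Tm!
ren! ρ (var n) = var (ρ n)
ren! ρ (app t u) = app (ren! ρ t) (ren! ρ u)
ren! ρ (lam t) = lam (ren! (ext ρ) t)
ren! ρ (bang t) = bang (ren! ρ t)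
ren! ρ (der t) = der (ren! ρ t)
ren! ρ (es t u) = es (ren! (ext ρ) t) (ren! ρ u)

exts! : (ℕ → Tm!) → ℕ → Tm!
exts! σ zero = var zero
exts! σ (suc n) = ren! suc (σ n)

sub! : (ℕ → Tm!) → Tm! → Tm!
sub! σ (var n) = σ n
sub! σ (app t u) = app (sub! σ t) (sub! σ u)
sub! σ (lam t) = lam (sub! (exts! σ) t)
sub! σ (bang t) = bang (sub! σ t)
sub! σ (der t) = der (sub! σ t)
sub! σ (es t u) = es (sub! (exts! σ) t) (sub! σ u)

-- List contexts L ::= □ | L[x\s]; a list [s₁, …, sₖ] denotes
-- □[x₁\s₁]…[xₖ\sₖ] (innermost first).  It binds k variables.
data LCtx! : Set where
  hole : LCtx!
  _[_] : LCtx! → Tm! → LCtx!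

plugL! : LCtx! → Tm! → Tm!
plugL! hole t = t
plugL! (L [ s ]) t = es (plugL! L t) s

lenL! : LCtx! → ℕ
lenL! hole = 0
lenL! (L [ s ]) = suc (lenL! L)

shift! : ℕ → Tm! → Tm!
shift! k = ren! (λ n → k + n)

-- substitution of index 0 by u, where the remaining free indices of the
-- body are moved under the k binders of a list context
substUnder! : ℕ → Tm! → Tm! → Tm!
substUnder! k t u = sub! σ t
  where
  σ : ℕ → Tm!
  σ zero = u
  σ (suc n) = var (k + n)

data _↦!_ : Tm! → Tm! → Set where
  dB!  : ∀ L t u → app (plugL! L (lam t)) u ↦! plugL! L (es t (shift! (lenL! L) u))
  s!   : ∀ t L u → es t (plugL! L (bang u)) ↦! plugL! L (substUnder! (lenL! L) t u)
  d!   : ∀ L t → der (plugL! L (bang t)) ↦! plugL! L t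

-- surface reduction: closure under surface contexts
-- S ::= □ | S t | t S | λx.S | der(S) | S[x\t] | t[x\S]   (never under !)
data _→S_ : Tm! → Tm! → Set where
  root  : ∀ {t t'} → t ↦! t' → t →S t'
  appL  : ∀ {t t'} u → t →S t' → app t u →S app t' u
  appR  : ∀ t {u u'} → u →S u' → app t u →S app t u'
  lamS  : ∀ {t t'} → t →S t' → lam t →S lam t'
  derS  : ∀ {t t'} → t →S t' → der t →S der t'
  esL   : ∀ {t t'} u → t →S t' → es t u →S es t' u
  esR   : ∀ t {u u'} → u →S u' → es t u →S es t u'

_→S*_ : Tm! → Tm! → Set
_→S*_ = Star _→S_

data TCtx! : Set where
  hole : TCtx!
  appT : TCtx! → Tm! → TCtx!
  redexT : TCtx! → Tm! → TCtx!

plugT! : TCtx! → Tm! → Tm!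
plugT! hole t = t
plugT! (appT T s) t = app (plugT! T t) s
plugT! (redexT T s) t = app (lam (plugT! T t)) s   -- plugging may capture

Meaningful! : Tm! → Set
Meaningful! t = ∃[ T ] ∃[ u ] (plugT! T t →S* bang u)

data Tmn : Set where
  var : ℕ → Tmn
  lam : Tmn → Tmn
  app : Tmn → Tmn → Tmn
  es  : Tmn → Tmn → Tmn

renn : (ℕ → ℕ) → Tmn → Tmn
renn ρ (var n) = var (ρ n)
renn ρ (lam t) = lam (renn (ext ρ) t)
renn ρ (app t u) = app (renn ρ t) (renn ρ u)
renn ρ (es t u) = es (renn (ext ρ) t) (renn ρ u)

extsn : (ℕ → Tmn) → ℕ → Tmn
extsn σ zero = var zero
extsn σ (suc n) = renn suc (σ n)

subn : (ℕ → Tmn) → Tmn → Tmn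
subn σ (var n) = σ n
subn σ (lam t) = lam (subn (extsn σ) t)
subn σ (app t u) = app (subn σ t) (subn σ u)
subn σ (es t u) = es (subn (extsn σ) t) (subn σ u)

data LCtxn : Set where
  hole : LCtxn
  _[_] : LCtxn → Tmn → LCtxn

plugLn : LCtxn → Tmn → Tmn
plugLn hole t = t
plugLn (L [ s ]) t = es (plugLn L t) s

lenLn : LCtxn → ℕ
lenLn hole = 0
lenLn (L [ s ]) = suc (lenLn L)

-- t{x:=u} for x = index 0 (remaining indices decremented)
subst0n : Tmn → Tmn → Tmn
subst0n t u = subn σ t
  where
  σ : ℕ → Tmn
  σ zero = u
  σ (suc n) = var n

data _↦n_ : Tmn → Tmn → Set where
  dBn : ∀ L t u → app (plugLn L (lam t)) u ↦n plugLn L (es t (renn (λ n → lenLn L + n) u))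
  sn  : ∀ t u → es t u ↦n subst0n t u

data _→n_ : Tmn → Tmn → Set where
  root : ∀ {t t'} → t ↦n t' → t →n t'
  appL : ∀ {t t'} u → t →n t' → app t u →n app t' u
  lamN : ∀ {t t'} → t →n t' → lam t →n lam t'
  esL  : ∀ {t t'} u → t →n t' → es t u →n es t' u

_→n*_ : Tmn → Tmn → Set
_→n*_ = Star _→n_

data TCtxn : Set where
  hole : TCtxn
  appT : TCtxn → Tmn → TCtxn
  redexT : TCtxn → Tmn → TCtxn

plugTn : TCtxn → Tmn → Tmn
plugTn hole t = t
plugTn (appT T s) t = app (plugTn T t) s
plugTn (redexT T s) t = app (lam (plugTn T t)) s

idn : Tmn
idn = lam (var zero)

Meaningfuln : Tmn → Set
Meaningfuln t = ∃[ T ] (plugTn T t →n* idn)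

_ⁿ : Tmn → Tm!
var x ⁿ = var x
lam t ⁿ = lam (t ⁿ)
app t u ⁿ = app (t ⁿ) (bang (u ⁿ))
es t u ⁿ = es (t ⁿ) (bang (u ⁿ))

-- (⇒) The embedding simulates surface reduction, and the image of λz.z applied to !!x
-- reduces to a !-value.
-- (⇐) Use non-idempotent intersection types for λ!.  A !-value is typable whatever its
-- content, and typability is stable under surface expansion, so a meaningful tⁿ is
-- typable.  On embedded terms every λn-step strictly decreases the size of a type
-- derivation, so head reduction of t terminates in a head normal form
-- λx₁…xₖ.y u₁…uₘ.  Such a term is λn-meaningful: a testing context supplies k arguments
-- and substitutes for y the term λy₁…yₘ.λz.z, which swallows the uᵢ.

module Submission where

open import Defs
open import Algebra.Bundles using (CommutativeMonoid)
import Algebra.Construct.Pointwise as Pointwise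
import Algebra.Properties.CommutativeSemigroup as CommSemigroupProperties
open import Data.List using (List; []; _∷_; _++_)
open import Data.List.Relation.Binary.Permutation.Propositional
  using (_↭_; prep; swap; ↭-refl; ↭-sym; ↭-trans; ↭-reflexive)
open import Data.List.Relation.Binary.Permutation.Propositional.Properties
  using (++⁺; ++⁺ˡ; ++⁺ʳ; ++-identityʳ; ++-commutativeMonoid)
open import Data.Nat using (ℕ; zero; suc; _+_; _≤_; _<_; z≤n; s≤s)
open import Data.Nat.Properties
  using (+-identityʳ; +-suc; +-assoc; ≤-refl; ≤-trans; ≤-pred; ≤-reflexive; +-mono-≤; +-monoʳ-≤
        ; +-monoˡ-<; n≤1+n; +-commutativeSemigroup; module ≤-Reasoning)
open import Data.Product using (Σ; _×_; _,_; proj₂)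
open import Data.Sum using (_⊎_; inj₁; inj₂)
open import Function.Base using (id; _∘_)
open import Function.Bundles using (_⇔_; mk⇔)
open import Relation.Binary.PropositionalEquality
  using (_≡_; refl; sym; trans; cong; cong₂; subst; subst₂; _≗_)
open import Relation.Binary.Construct.Closure.ReflexiveTransitive using (ε; _◅_; _◅◅_; gmap)

ext-cong : ∀ {ρ ρ'} → ρ ≗ ρ' → ext ρ ≗ ext ρ'
ext-cong e zero = refl
ext-cong e (suc x) = cong suc (e x)

ext-∘ : ∀ ρ ρ' → ext ρ ∘ ext ρ' ≗ ext (ρ ∘ ρ')
ext-∘ ρ ρ' zero = refl
ext-∘ ρ ρ' (suc x) = refl

ext-id : ∀ {ρ} → ρ ≗ id → ext ρ ≗ id
ext-id e zero = refl
ext-id e (suc x) = cong suc (e x)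

ren!-cong : ∀ {ρ ρ'} → ρ ≗ ρ' → ren! ρ ≗ ren! ρ'
ren!-cong e (var x) = cong var (e x)
ren!-cong e (app t u) = cong₂ app (ren!-cong e t) (ren!-cong e u)
ren!-cong e (lam t) = cong lam (ren!-cong (ext-cong e) t)
ren!-cong e (bang t) = cong bang (ren!-cong e t)
ren!-cong e (der t) = cong der (ren!-cong e t)
ren!-cong e (es t u) = cong₂ es (ren!-cong (ext-cong e) t) (ren!-cong e u)

ren!-∘ : ∀ ρ ρ' → ren! ρ ∘ ren! ρ' ≗ ren! (ρ ∘ ρ')
ren!-∘ ρ ρ' (var x) = refl
ren!-∘ ρ ρ' (app t u) = cong₂ app (ren!-∘ ρ ρ' t) (ren!-∘ ρ ρ' u)
ren!-∘ ρ ρ' (lam t) = cong lam (trans (ren!-∘ (ext ρ) (ext ρ') t) (ren!-cong (ext-∘ ρ ρ') t))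
ren!-∘ ρ ρ' (bang t) = cong bang (ren!-∘ ρ ρ' t)
ren!-∘ ρ ρ' (der t) = cong der (ren!-∘ ρ ρ' t)
ren!-∘ ρ ρ' (es t u) =
  cong₂ es (trans (ren!-∘ (ext ρ) (ext ρ') t) (ren!-cong (ext-∘ ρ ρ') t)) (ren!-∘ ρ ρ' u)

ren!-id : ∀ {ρ} → ρ ≗ id → ren! ρ ≗ id
ren!-id e (var x) = cong var (e x)
ren!-id e (app t u) = cong₂ app (ren!-id e t) (ren!-id e u)
ren!-id e (lam t) = cong lam (ren!-id (ext-id e) t)
ren!-id e (bang t) = cong bang (ren!-id e t)
ren!-id e (der t) = cong der (ren!-id e t)
ren!-id e (es t u) = cong₂ es (ren!-id (ext-id e) t) (ren!-id e u)

renn-id : ∀ {ρ} → ρ ≗ id → renn ρ ≗ id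
renn-id e (var x) = cong var (e x)
renn-id e (lam t) = cong lam (renn-id (ext-id e) t)
renn-id e (app t u) = cong₂ app (renn-id e t) (renn-id e u)
renn-id e (es t u) = cong₂ es (renn-id (ext-id e) t) (renn-id e u)

exts!-cong : ∀ {σ τ} → σ ≗ τ → exts! σ ≗ exts! τ
exts!-cong e zero = refl
exts!-cong e (suc x) = cong (ren! suc) (e x)

exts!-ext : ∀ σ ρ → exts! σ ∘ ext ρ ≗ exts! (σ ∘ ρ)
exts!-ext σ ρ zero = refl
exts!-ext σ ρ (suc x) = refl

sub!-cong : ∀ {σ τ} → σ ≗ τ → sub! σ ≗ sub! τ
sub!-cong e (var x) = e x
sub!-cong e (app t u) = cong₂ app (sub!-cong e t) (sub!-cong e u)
sub!-cong e (lam t) = cong lam (sub!-cong (exts!-cong e) t)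
sub!-cong e (bang t) = cong bang (sub!-cong e t)
sub!-cong e (der t) = cong der (sub!-cong e t)
sub!-cong e (es t u) = cong₂ es (sub!-cong (exts!-cong e) t) (sub!-cong e u)

sub!-ren! : ∀ σ ρ → sub! σ ∘ ren! ρ ≗ sub! (σ ∘ ρ)
sub!-ren! σ ρ (var x) = refl
sub!-ren! σ ρ (app t u) = cong₂ app (sub!-ren! σ ρ t) (sub!-ren! σ ρ u)
sub!-ren! σ ρ (lam t) =
  cong lam (trans (sub!-ren! (exts! σ) (ext ρ) t) (sub!-cong (exts!-ext σ ρ) t))
sub!-ren! σ ρ (bang t) = cong bang (sub!-ren! σ ρ t)
sub!-ren! σ ρ (der t) = cong der (sub!-ren! σ ρ t)
sub!-ren! σ ρ (es t u) =
  cong₂ es (trans (sub!-ren! (exts! σ) (ext ρ) t) (sub!-cong (exts!-ext σ ρ) t)) (sub!-ren! σ ρ u)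

-- substAt i w replaces the free index i by w and closes the gap; thin j opens a gap at j.
substAt : ℕ → Tm! → ℕ → Tm!
substAt zero w zero = w
substAt zero w (suc x) = var x
substAt (suc i) w = exts! (substAt i w)

thin : ℕ → ℕ → ℕ
thin zero = suc
thin (suc j) = ext (thin j)

shift!-zero : ∀ u → shift! 0 u ≡ u
shift!-zero = ren!-id λ _ → refl

shift!-suc : ∀ k u → shift! (suc k) u ≡ shift! k (ren! suc u)
shift!-suc k u = sym (trans (ren!-∘ (k +_) suc u) (ren!-cong (+-suc k) u))

substUnder!-zero : ∀ t u → substUnder! 0 t u ≡ sub! (substAt 0 u) t
substUnder!-zero t u = sub!-cong (λ { zero → refl ; (suc x) → refl }) t

substUnder!-suc : ∀ k t u → substUnder! (suc k) t u ≡ substUnder! k (ren! (thin 1) t) u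
substUnder!-suc k t u = sym (trans (sub!-ren! _ (thin 1) t) (sub!-cong shifted t))
  where
  shifted : ∀ x → substUnder! k (ren! (thin 1) (var x)) u ≡ substUnder! (suc k) (var x) u
  shifted zero = refl
  shifted (suc x) = cong var (+-suc k x)

substAt-view : ∀ i w x → (x ≡ i) ⊎ (Σ ℕ λ y → (thin i y ≡ x) × (substAt i w x ≡ var y))
substAt-view zero w zero = inj₁ refl
substAt-view zero w (suc x) = inj₂ (x , refl , refl)
substAt-view (suc i) w zero = inj₂ (zero , refl , refl)
substAt-view (suc i) w (suc x) with substAt-view i w x
... | inj₁ e = inj₁ (cong suc e)
... | inj₂ (y , e1 , e2) = inj₂ (suc y , cong suc e1 , cong (ren! suc) e2)

ⁿ-ren : ∀ ρ t → renn ρ t ⁿ ≡ ren! ρ (t ⁿ)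
ⁿ-ren ρ (var x) = refl
ⁿ-ren ρ (lam t) = cong lam (ⁿ-ren (ext ρ) t)
ⁿ-ren ρ (app t u) = cong₂ app (ⁿ-ren ρ t) (cong bang (ⁿ-ren ρ u))
ⁿ-ren ρ (es t u) = cong₂ es (ⁿ-ren (ext ρ) t) (cong bang (ⁿ-ren ρ u))

ⁿ-exts : ∀ σ → _ⁿ ∘ extsn σ ≗ exts! (_ⁿ ∘ σ)
ⁿ-exts σ zero = refl
ⁿ-exts σ (suc x) = ⁿ-ren suc (σ x)

ⁿ-sub : ∀ σ t → subn σ t ⁿ ≡ sub! (_ⁿ ∘ σ) (t ⁿ)
ⁿ-sub σ (var x) = refl
ⁿ-sub σ (lam t) = cong lam (trans (ⁿ-sub (extsn σ) t) (sub!-cong (ⁿ-exts σ) (t ⁿ)))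
ⁿ-sub σ (app t u) = cong₂ app (ⁿ-sub σ t) (cong bang (ⁿ-sub σ u))
ⁿ-sub σ (es t u) =
  cong₂ es (trans (ⁿ-sub (extsn σ) t) (sub!-cong (ⁿ-exts σ) (t ⁿ))) (cong bang (ⁿ-sub σ u))

ⁿ-subst0 : ∀ t u → subst0n t u ⁿ ≡ sub! (substAt 0 (u ⁿ)) (t ⁿ)
ⁿ-subst0 t u = trans (ⁿ-sub _ t) (sub!-cong (λ { zero → refl ; (suc x) → refl }) (t ⁿ))

Lⁿ : LCtxn → LCtx!
Lⁿ hole = hole
Lⁿ (L [ s ]) = Lⁿ L [ bang (s ⁿ) ]

ⁿ-plugL : ∀ L t → plugLn L t ⁿ ≡ plugL! (Lⁿ L) (t ⁿ)
ⁿ-plugL hole t = refl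
ⁿ-plugL (L [ s ]) t = cong (λ z → es z (bang (s ⁿ))) (ⁿ-plugL L t)

lenL!-Lⁿ : ∀ L → lenL! (Lⁿ L) ≡ lenLn L
lenL!-Lⁿ hole = refl
lenL!-Lⁿ (L [ s ]) = cong suc (lenL!-Lⁿ L)

Tⁿ : TCtxn → TCtx!
Tⁿ hole = hole
Tⁿ (appT T s) = appT (Tⁿ T) (bang (s ⁿ))
Tⁿ (redexT T s) = redexT (Tⁿ T) (bang (s ⁿ))

ⁿ-plugT : ∀ T t → plugTn T t ⁿ ≡ plugT! (Tⁿ T) (t ⁿ)
ⁿ-plugT hole t = refl
ⁿ-plugT (appT T s) t = cong (λ z → app z (bang (s ⁿ))) (ⁿ-plugT T t)
ⁿ-plugT (redexT T s) t = cong (λ z → app (lam z) (bang (s ⁿ))) (ⁿ-plugT T t)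

ⁿ-dB-redex : ∀ L t u → app (plugLn L (lam t)) u ⁿ ≡ app (plugL! (Lⁿ L) (lam (t ⁿ))) (bang (u ⁿ))
ⁿ-dB-redex L t u = cong (λ z → app z (bang (u ⁿ))) (ⁿ-plugL L (lam t))

ⁿ-dB-contractum : ∀ L t u → plugLn L (es t (renn (lenLn L +_) u)) ⁿ
                              ≡ plugL! (Lⁿ L) (es (t ⁿ) (shift! (lenL! (Lⁿ L)) (bang (u ⁿ))))
ⁿ-dB-contractum L t u = trans (ⁿ-plugL L _) (cong (λ z → plugL! (Lⁿ L) (es (t ⁿ) (bang z)))
  (trans (ⁿ-ren _ u) (cong (λ k → ren! (k +_) (u ⁿ)) (sym (lenL!-Lⁿ L)))))

ⁿ-s-contractum : ∀ t u → substUnder! 0 (t ⁿ) (u ⁿ) ≡ subst0n t u ⁿ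
ⁿ-s-contractum t u = trans (substUnder!-zero (t ⁿ) (u ⁿ)) (sym (ⁿ-subst0 t u))

ⁿ-step : ∀ {t t'} → t →n t' → (t ⁿ) →S (t' ⁿ)
ⁿ-step (root (dBn L t u)) =
  subst₂ _→S_ (sym (ⁿ-dB-redex L t u)) (sym (ⁿ-dB-contractum L t u))
         (root (dB! (Lⁿ L) (t ⁿ) (bang (u ⁿ))))
ⁿ-step (root (sn t u)) =
  subst (es (t ⁿ) (bang (u ⁿ)) →S_) (ⁿ-s-contractum t u) (root (s! (t ⁿ) hole (u ⁿ)))
ⁿ-step (appL u r) = appL (bang (u ⁿ)) (ⁿ-step r)
ⁿ-step (lamN r) = lamS (ⁿ-step r)
ⁿ-step (esL u r) = esL (bang (u ⁿ)) (ⁿ-step r)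

ⁿ-steps : ∀ {t t'} → t →n* t' → (t ⁿ) →S* (t' ⁿ)
ⁿ-steps = gmap _ⁿ ⁿ-step

Meaningfuln⇒Meaningful!ⁿ : ∀ t → Meaningfuln t → Meaningful! (t ⁿ)
Meaningfuln⇒Meaningful!ⁿ t (T , T⟨t⟩↠id) =
  appT (Tⁿ T) !!x₀ , var 0 ,
  gmap (λ s → app s !!x₀) (appL !!x₀) (subst (_→S* (idn ⁿ)) (ⁿ-plugT T t) (ⁿ-steps T⟨t⟩↠id))
  ◅◅ root (dB! hole (var 0) !!x₀) ◅ root (s! (var 0) hole (bang (var 0))) ◅ ε
  where
  !!x₀ : Tm!
  !!x₀ = bang (bang (var 0))

module ℕ+ = CommSemigroupProperties +-commutativeSemigroup

↭-++-emptyˡ : ∀ {A : Set} {xs ys zs : List A} → xs ↭ [] → xs ++ ys ↭ zs → ys ↭ zs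
↭-++-emptyˡ xs↭[] p = ↭-trans (++⁺ʳ _ (↭-sym xs↭[])) p

↭-++-emptyʳ : ∀ {A : Set} {xs ys zs : List A} → ys ↭ [] → xs ++ ys ↭ zs → xs ↭ zs
↭-++-emptyʳ ys↭[] p = ↭-trans (↭-sym (++-identityʳ _)) (↭-trans (++⁺ˡ _ (↭-sym ys↭[])) p)

-- Multisets are lists up to permutation; !t has type mul M when t has each type in M.
data Ty : Set where
  _⇒_ : List Ty → Ty → Ty
  mul : List Ty → Ty

Env : Set
Env = ℕ → List Ty

infixl 6 _⊹_
infixr 5 _∷ₑ_
infix 4 _≈_

∅ : Env
∅ _ = []

_⊹_ : Env → Env → Env
(Γ ⊹ Δ) n = Γ n ++ Δ n

_∷ₑ_ : List Ty → Env → Env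
(M ∷ₑ Γ) zero = M
(M ∷ₑ Γ) (suc n) = Γ n

tl : Env → Env
tl Γ n = Γ (suc n)

_∘ₑ_ : Env → (ℕ → ℕ) → Env
(Γ ∘ₑ ρ) x = Γ (ρ x)

single : ℕ → Ty → Env
single zero σ zero = σ ∷ []
single zero σ (suc y) = []
single (suc x) σ zero = []
single (suc x) σ (suc y) = single x σ y

_≈_ : Env → Env → Set
Γ ≈ Δ = ∀ n → Γ n ↭ Δ n

envMonoid : CommutativeMonoid _ _
envMonoid = Pointwise.commutativeMonoid ℕ (++-commutativeMonoid {A = Ty})

open CommutativeMonoid envMonoid using ()
  renaming (refl to ≈-refl; sym to ≈-sym; trans to ≈-trans; ∙-cong to ⊹-cong
           ; assoc to ⊹-assoc; identityˡ to ⊹-identityˡ; identityʳ to ⊹-identityʳ)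
module ⊹ = CommSemigroupProperties (CommutativeMonoid.commutativeSemigroup envMonoid)

≈-⊹-interchange : ∀ {Ξ Ξ1 Ξ2} A B C D →
  Ξ ≈ Ξ1 ⊹ Ξ2 → Ξ1 ≈ A ⊹ B → Ξ2 ≈ C ⊹ D → Ξ ≈ (A ⊹ C) ⊹ (B ⊹ D)
≈-⊹-interchange A B C D e e1 e2 = ≈-trans e (≈-trans (⊹-cong e1 e2) (⊹.interchange A B C D))

∷ₑ-cong : ∀ {M M' Γ Γ'} → M ↭ M' → Γ ≈ Γ' → M ∷ₑ Γ ≈ M' ∷ₑ Γ'
∷ₑ-cong m e zero = m
∷ₑ-cong m e (suc n) = e n

∘ₑ-cong : ∀ ρ {Γ Δ} → Γ ≈ Δ → Γ ∘ₑ ρ ≈ Δ ∘ₑ ρ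
∘ₑ-cong ρ e x = e (ρ x)

∘ₑ-⊹-interchange : ∀ ρ {Δ W} Δ1 Δ2 W1 W2 → Δ ≈ Δ1 ⊹ Δ2 → W ≈ W1 ⊹ W2 →
  (Δ ∘ₑ ρ) ⊹ W ≈ ((Δ1 ∘ₑ ρ) ⊹ W1) ⊹ ((Δ2 ∘ₑ ρ) ⊹ W2)
∘ₑ-⊹-interchange ρ Δ1 Δ2 W1 W2 e eW =
  ≈-⊹-interchange (Δ1 ∘ₑ ρ) (Δ2 ∘ₑ ρ) W1 W2 ≈-refl (∘ₑ-cong ρ e) eW

tl-cong : ∀ {Γ Δ} → Γ ≈ Δ → tl Γ ≈ tl Δ
tl-cong e n = e (suc n)

∷ₑ-≈-tl : ∀ {Δ Δ' M Γ} → Δ ≈ M ∷ₑ Γ → Δ ≈ Δ' → Γ ≈ tl Δ'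
∷ₑ-≈-tl e e' = ≈-trans (≈-sym (tl-cong e)) (tl-cong e')

≈-∷ₑ-tl : ∀ {Δ M} → Δ zero ↭ M → Δ ≈ M ∷ₑ tl Δ
≈-∷ₑ-tl Δ₀↭M zero = Δ₀↭M
≈-∷ₑ-tl Δ₀↭M (suc n) = ↭-refl

mutual
  data _⊢_∶_ : Env → Tm! → Ty → Set where
    ⊢var : ∀ {Γ x σ} → Γ ≈ single x σ → Γ ⊢ var x ∶ σ
    ⊢lam : ∀ {Γ Δ M t σ} → Δ ⊢ t ∶ σ → Δ ≈ M ∷ₑ Γ → Γ ⊢ lam t ∶ (M ⇒ σ)
    ⊢app : ∀ {Γ Γ1 Γ2 M t u σ} →
           Γ1 ⊢ t ∶ (M ⇒ σ) → Γ2 ⊢ u ∶ mul M → Γ ≈ Γ1 ⊹ Γ2 → Γ ⊢ app t u ∶ σ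
    ⊢es  : ∀ {Γ Γ1 Γ2 Δ M t u σ} →
           Δ ⊢ t ∶ σ → Δ ≈ M ∷ₑ Γ1 → Γ2 ⊢ u ∶ mul M → Γ ≈ Γ1 ⊹ Γ2 → Γ ⊢ es t u ∶ σ
    ⊢bang : ∀ {Γ t M} → Γ ⊩ t ∶ M → Γ ⊢ bang t ∶ mul M
    ⊢der : ∀ {Γ t σ} → Γ ⊢ t ∶ mul (σ ∷ []) → Γ ⊢ der t ∶ σ

  data _⊩_∶_ : Env → Tm! → List Ty → Set where
    ⊩[] : ∀ {Γ t} → Γ ≈ ∅ → Γ ⊩ t ∶ []
    ⊩∷ : ∀ {Γ Γ1 Γ2 t σ M} → Γ1 ⊢ t ∶ σ → Γ2 ⊩ t ∶ M → Γ ≈ Γ1 ⊹ Γ2 → Γ ⊩ t ∶ (σ ∷ M)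

infix 3 _⊢_∶_ _⊩_∶_

mutual
  size : ∀ {Γ t σ} → Γ ⊢ t ∶ σ → ℕ
  size (⊢var _) = 1
  size (⊢lam d _) = suc (size d)
  size (⊢app d f _) = suc (size d + size f)
  size (⊢es d _ f _) = suc (size d + size f)
  size (⊢bang b) = suc (size⊩ b)
  size (⊢der d) = suc (size d)

  size⊩ : ∀ {Γ t M} → Γ ⊩ t ∶ M → ℕ
  size⊩ (⊩[] _) = 0
  size⊩ (⊩∷ d b _) = size d + size⊩ b

⊢-≡ : ∀ {Γ t t' σ} → t ≡ t' → Γ ⊢ t ∶ σ → Γ ⊢ t' ∶ σ
⊢-≡ refl d = d

size-⊢-≡ : ∀ {Γ t t' σ} (e : t ≡ t') (d : Γ ⊢ t ∶ σ) → size (⊢-≡ e d) ≡ size d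
size-⊢-≡ refl d = refl

mutual
  ⊢-resp-≈ : ∀ {Γ Γ' t σ} → Γ ⊢ t ∶ σ → Γ ≈ Γ' → Γ' ⊢ t ∶ σ
  ⊢-resp-≈ (⊢var e) c = ⊢var (≈-trans (≈-sym c) e)
  ⊢-resp-≈ (⊢lam d e) c = ⊢lam d (≈-trans e (∷ₑ-cong ↭-refl c))
  ⊢-resp-≈ (⊢app d f e) c = ⊢app d f (≈-trans (≈-sym c) e)
  ⊢-resp-≈ (⊢es d e1 f e) c = ⊢es d e1 f (≈-trans (≈-sym c) e)
  ⊢-resp-≈ (⊢bang b) c = ⊢bang (⊩-resp-≈ b c)
  ⊢-resp-≈ (⊢der d) c = ⊢der (⊢-resp-≈ d c)

  ⊩-resp-≈ : ∀ {Γ Γ' t M} → Γ ⊩ t ∶ M → Γ ≈ Γ' → Γ' ⊩ t ∶ M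
  ⊩-resp-≈ (⊩[] e) c = ⊩[] (≈-trans (≈-sym c) e)
  ⊩-resp-≈ (⊩∷ d b e) c = ⊩∷ d b (≈-trans (≈-sym c) e)

mutual
  size-⊢-resp-≈ : ∀ {Γ Γ' t σ} (d : Γ ⊢ t ∶ σ) (c : Γ ≈ Γ') → size (⊢-resp-≈ d c) ≡ size d
  size-⊢-resp-≈ (⊢var e) c = refl
  size-⊢-resp-≈ (⊢lam d e) c = refl
  size-⊢-resp-≈ (⊢app d f e) c = refl
  size-⊢-resp-≈ (⊢es d e1 f e) c = refl
  size-⊢-resp-≈ (⊢bang b) c = cong suc (size-⊩-resp-≈ b c)
  size-⊢-resp-≈ (⊢der d) c = cong suc (size-⊢-resp-≈ d c)

  size-⊩-resp-≈ : ∀ {Γ Γ' t M} (b : Γ ⊩ t ∶ M) (c : Γ ≈ Γ') → size⊩ (⊩-resp-≈ b c) ≡ size⊩ b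
  size-⊩-resp-≈ (⊩[] e) c = refl
  size-⊩-resp-≈ (⊩∷ d b e) c = refl

⊩-++ : ∀ {Γ1 Γ2 t A B} → Γ1 ⊩ t ∶ A → Γ2 ⊩ t ∶ B → Γ1 ⊹ Γ2 ⊩ t ∶ (A ++ B)
⊩-++ {Γ2 = Γ2} (⊩[] e) b = ⊩-resp-≈ b (≈-sym (≈-trans (⊹-cong e ≈-refl) (⊹-identityˡ Γ2)))
⊩-++ {Γ2 = Γ2} (⊩∷ {Γ1 = Δ1} {Γ2 = Δ2} d b e) b' =
  ⊩∷ d (⊩-++ b b') (≈-trans (⊹-cong e ≈-refl) (⊹-assoc Δ1 Δ2 Γ2))

⊩-↭ : ∀ {Γ t A B} → (b : Γ ⊩ t ∶ A) → A ↭ B → Σ (Γ ⊩ t ∶ B) λ b' → size⊩ b' ≡ size⊩ b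
⊩-↭ b _↭_.refl = b , refl
⊩-↭ (⊩∷ d b e) (prep _ p) with ⊩-↭ b p
... | b' , eq = ⊩∷ d b' e , cong (size d +_) eq
⊩-↭ (⊩∷ {Γ1 = Γ1} d (⊩∷ {Γ1 = Γ3} {Γ2 = Γ4} d2 b e2) e) (swap _ _ p) with ⊩-↭ b p
... | b' , eq =
  ⊩∷ d2 (⊩∷ d b' ≈-refl) (≈-trans e (≈-trans (⊹-cong ≈-refl e2) (⊹.x∙yz≈y∙xz Γ1 Γ3 Γ4))) ,
  trans (cong (λ z → size d2 + (size d + z)) eq) (ℕ+.x∙yz≈y∙xz (size d2) (size d) (size⊩ b))
⊩-↭ b (_↭_.trans p q) with ⊩-↭ b p
... | b1 , e1 with ⊩-↭ b1 q
... | b2 , e2 = b2 , trans e2 e1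

⊩-split-++ : ∀ {Γ t} A {B} → (b : Γ ⊩ t ∶ (A ++ B)) →
  Σ Env λ Γ1 → Σ Env λ Γ2 → Σ (Γ1 ⊩ t ∶ A) λ b1 → Σ (Γ2 ⊩ t ∶ B) λ b2 →
    (Γ ≈ Γ1 ⊹ Γ2) × (size⊩ b ≡ size⊩ b1 + size⊩ b2)
⊩-split-++ {Γ} [] b = ∅ , Γ , ⊩[] ≈-refl , b , ≈-refl , refl
⊩-split-++ (σ ∷ A) (⊩∷ {Γ1 = Δ1} d b e) with ⊩-split-++ A b
... | Γ1 , Γ2 , b1 , b2 , e' , sz =
  Δ1 ⊹ Γ1 , Γ2 , ⊩∷ d b1 ≈-refl , b2 ,
  ≈-trans e (≈-trans (⊹-cong ≈-refl e') (≈-sym (⊹-assoc Δ1 Γ1 Γ2))) ,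
  trans (cong (size d +_) sz) (sym (+-assoc (size d) _ _))

⊩-split : ∀ {Γ t} A {B C} → (b : Γ ⊩ t ∶ C) → C ↭ A ++ B →
  Σ Env λ Γ1 → Σ Env λ Γ2 → Σ (Γ1 ⊩ t ∶ A) λ b1 → Σ (Γ2 ⊩ t ∶ B) λ b2 →
    (Γ ≈ Γ1 ⊹ Γ2) × (size⊩ b ≡ size⊩ b1 + size⊩ b2)
⊩-split A b C↭A++B with ⊩-↭ b C↭A++B
... | b' , s' with ⊩-split-++ A b'
... | Γ1 , Γ2 , b1 , b2 , e , s = Γ1 , Γ2 , b1 , b2 , e , trans (sym s') s

⊩-single : ∀ {Γ t σ} → Γ ⊢ t ∶ σ → Γ ⊩ t ∶ (σ ∷ [])
⊩-single {Γ} d = ⊩∷ d (⊩[] ≈-refl) (≈-sym (⊹-identityʳ Γ))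

⊩-single⁻ : ∀ {Γ t σ} → (b : Γ ⊩ t ∶ (σ ∷ [])) → Σ (Γ ⊢ t ∶ σ) λ d → size d ≡ size⊩ b
⊩-single⁻ (⊩∷ {Γ1 = Γ1} d (⊩[] e') e) =
  ⊢-resp-≈ d (≈-sym (≈-trans e (≈-trans (⊹-cong ≈-refl e') (⊹-identityʳ Γ1)))) ,
  trans (size-⊢-resp-≈ d _) (sym (+-identityʳ (size d)))

-- pad j Γ inserts an empty slot at j; it is the environment counterpart of thin j.
pad : ℕ → Env → Env
pad zero Γ = [] ∷ₑ Γ
pad (suc j) Γ = Γ zero ∷ₑ pad j (tl Γ)

pad-cong : ∀ j {Γ Δ} → Γ ≈ Δ → pad j Γ ≈ pad j Δ
pad-cong zero e zero = ↭-refl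
pad-cong zero e (suc n) = e n
pad-cong (suc j) e zero = e zero
pad-cong (suc j) e (suc n) = pad-cong j (tl-cong e) n

pad-⊹ : ∀ j Γ Δ → pad j (Γ ⊹ Δ) ≈ pad j Γ ⊹ pad j Δ
pad-⊹ zero Γ Δ zero = ↭-refl
pad-⊹ zero Γ Δ (suc n) = ↭-refl
pad-⊹ (suc j) Γ Δ zero = ↭-refl
pad-⊹ (suc j) Γ Δ (suc n) = pad-⊹ j (tl Γ) (tl Δ) n

pad-∅ : ∀ j → pad j ∅ ≈ ∅
pad-∅ zero zero = ↭-refl
pad-∅ zero (suc n) = ↭-refl
pad-∅ (suc j) zero = ↭-refl
pad-∅ (suc j) (suc n) = pad-∅ j n

pad-single : ∀ j x σ → pad j (single x σ) ≈ single (thin j x) σ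
pad-single zero x σ zero = ↭-refl
pad-single zero x σ (suc n) = ↭-refl
pad-single (suc j) zero σ zero = ↭-refl
pad-single (suc j) zero σ (suc n) = pad-∅ j n
pad-single (suc j) (suc x) σ zero = ↭-refl
pad-single (suc j) (suc x) σ (suc n) = pad-single j x σ n

pad-∷ₑ : ∀ j M Γ → pad (suc j) (M ∷ₑ Γ) ≈ M ∷ₑ pad j Γ
pad-∷ₑ j M Γ zero = ↭-refl
pad-∷ₑ j M Γ (suc n) = ↭-refl

∘ₑ-ext : ∀ ρ {D M Δ} → D ≈ M ∷ₑ Δ → D ∘ₑ ext ρ ≈ M ∷ₑ (Δ ∘ₑ ρ)
∘ₑ-ext ρ e zero = e zero
∘ₑ-ext ρ e (suc z) = e (suc (ρ z))

⊹-pad-∷ₑ : ∀ {D M Δ} W → D ≈ M ∷ₑ Δ → D ⊹ pad 0 W ≈ M ∷ₑ (Δ ⊹ W)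
⊹-pad-∷ₑ W e zero = ↭-trans (++-identityʳ _) (e zero)
⊹-pad-∷ₑ W e (suc z) = ++⁺ʳ (W z) (e (suc z))

single-thin : ∀ j x z σ → single (thin j x) σ (thin j z) ≡ single x σ z
single-thin zero x z σ = refl
single-thin (suc j) zero zero σ = refl
single-thin (suc j) zero (suc z) σ = refl
single-thin (suc j) (suc x) zero σ = refl
single-thin (suc j) (suc x) (suc z) σ = single-thin j x z σ

single-thin-gap : ∀ j x σ → single (thin j x) σ j ≡ []
single-thin-gap zero x σ = refl
single-thin-gap (suc j) zero σ = refl
single-thin-gap (suc j) (suc x) σ = single-thin-gap j x σ

single-self : ∀ i σ → single i σ i ≡ σ ∷ []
single-self zero σ = refl
single-self (suc i) σ = single-self i σ

single-at-thin : ∀ i σ z → single i σ (thin i z) ≡ []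
single-at-thin zero σ z = refl
single-at-thin (suc i) σ zero = refl
single-at-thin (suc i) σ (suc z) = single-at-thin i σ z

mutual
  ⊢-weaken : ∀ j {Γ t σ} → (d : Γ ⊢ t ∶ σ) → Σ (pad j Γ ⊢ ren! (thin j) t ∶ σ) λ d' → size d' ≡ size d
  ⊢-weaken j {t = var x} (⊢var {σ = σ} e) = ⊢var (≈-trans (pad-cong j e) (pad-single j x σ)) , refl
  ⊢-weaken j {Γ} (⊢lam {M = M} d e) with ⊢-weaken (suc j) d
  ... | d' , s = ⊢lam d' (≈-trans (pad-cong (suc j) e) (pad-∷ₑ j M Γ)) , cong suc s
  ⊢-weaken j (⊢app {Γ1 = Γ1} {Γ2 = Γ2} d f e) with ⊢-weaken j d | ⊢-weaken j f
  ... | d' , s | f' , s' =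
    ⊢app d' f' (≈-trans (pad-cong j e) (pad-⊹ j Γ1 Γ2)) , cong suc (cong₂ _+_ s s')
  ⊢-weaken j (⊢es {Γ1 = Γ1} {Γ2 = Γ2} {M = M} d e1 f e) with ⊢-weaken (suc j) d | ⊢-weaken j f
  ... | d' , s | f' , s' =
    ⊢es d' (≈-trans (pad-cong (suc j) e1) (pad-∷ₑ j M Γ1)) f'
        (≈-trans (pad-cong j e) (pad-⊹ j Γ1 Γ2)) ,
    cong suc (cong₂ _+_ s s')
  ⊢-weaken j (⊢bang b) with ⊩-weaken j b
  ... | b' , s = ⊢bang b' , cong suc s
  ⊢-weaken j (⊢der d) with ⊢-weaken j d
  ... | d' , s = ⊢der d' , cong suc s

  ⊩-weaken : ∀ j {Γ t M} → (b : Γ ⊩ t ∶ M) → Σ (pad j Γ ⊩ ren! (thin j) t ∶ M) λ b' → size⊩ b' ≡ size⊩ b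
  ⊩-weaken j (⊩[] e) = ⊩[] (≈-trans (pad-cong j e) (pad-∅ j)) , refl
  ⊩-weaken j (⊩∷ {Γ1 = Γ1} {Γ2 = Γ2} d b e) with ⊢-weaken j d | ⊩-weaken j b
  ... | d' , s | b' , s' = ⊩∷ d' b' (≈-trans (pad-cong j e) (pad-⊹ j Γ1 Γ2)) , cong₂ _+_ s s'

mutual
  ⊢-strengthen : ∀ j {Γ σ} t → Γ ⊢ ren! (thin j) t ∶ σ → ((Γ ∘ₑ thin j) ⊢ t ∶ σ) × (Γ j ↭ [])
  ⊢-strengthen j (var x) (⊢var {σ = σ} e) =
    ⊢var (λ z → ↭-trans (e (thin j z)) (↭-reflexive (single-thin j x z σ))) ,
    ↭-trans (e j) (↭-reflexive (single-thin-gap j x σ))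
  ⊢-strengthen j (lam t) (⊢lam d e) with ⊢-strengthen (suc j) t d
  ... | d' , h = ⊢lam d' (∘ₑ-ext (thin j) e) , ↭-trans (↭-sym (e (suc j))) h
  ⊢-strengthen j (app t u) (⊢app d f e) with ⊢-strengthen j t d | ⊢-strengthen j u f
  ... | d' , h | f' , h' = ⊢app d' f' (∘ₑ-cong (thin j) e) , ↭-trans (e j) (++⁺ h h')
  ⊢-strengthen j (es t u) (⊢es d e1 f e) with ⊢-strengthen (suc j) t d | ⊢-strengthen j u f
  ... | d' , h | f' , h' =
    ⊢es d' (∘ₑ-ext (thin j) e1) f' (∘ₑ-cong (thin j) e) ,
    ↭-trans (e j) (++⁺ (↭-trans (↭-sym (e1 (suc j))) h) h')
  ⊢-strengthen j (bang t) (⊢bang b) with ⊩-strengthen j t b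
  ... | b' , h = ⊢bang b' , h
  ⊢-strengthen j (der t) (⊢der d) with ⊢-strengthen j t d
  ... | d' , h = ⊢der d' , h

  ⊩-strengthen : ∀ j {Γ M} t → Γ ⊩ ren! (thin j) t ∶ M → ((Γ ∘ₑ thin j) ⊩ t ∶ M) × (Γ j ↭ [])
  ⊩-strengthen j t (⊩[] e) = ⊩[] (∘ₑ-cong (thin j) e) , e j
  ⊩-strengthen j t (⊩∷ d b e) with ⊢-strengthen j t d | ⊩-strengthen j t b
  ... | d' , h | b' , h' = ⊩∷ d' b' (∘ₑ-cong (thin j) e) , ↭-trans (e j) (++⁺ h h')

≤-+-interchange : ∀ {m n} a c b1 b2 {b} → m ≤ a + b1 → n ≤ c + b2 → b ≡ b1 + b2 → m + n ≤ (a + c) + b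
≤-+-interchange a c b1 b2 p q refl = ≤-trans (+-mono-≤ p q) (≤-reflexive (ℕ+.interchange a b1 c b2))

⊩-weaken-↭ : ∀ {W t A B} (b : W ⊩ t ∶ A) → A ↭ B →
  Σ (pad 0 W ⊩ ren! suc t ∶ B) λ b' → size⊩ b' ≡ size⊩ b
⊩-weaken-↭ b p with ⊩-weaken 0 b
... | b1 , s1 with ⊩-↭ b1 p
... | b2 , s2 = b2 , trans s2 s1

⊢-subst-var : ∀ i w {Δ W τ} x → Δ ≈ single x τ → (b : W ⊩ substAt i w i ∶ Δ i) →
  Σ ((Δ ∘ₑ thin i) ⊹ W ⊢ substAt i w x ∶ τ) λ d' → size d' ≤ 1 + size⊩ b
⊢-subst-var i w {W = W} {τ} x e b with substAt-view i w x
... | inj₁ refl with ⊩-↭ b (↭-trans (e i) (↭-reflexive (single-self i τ)))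
... | b' , s1 with ⊩-single⁻ b'
... | d , s2 =
  ⊢-resp-≈ d (λ z → ↭-sym (++⁺ʳ (W z) (↭-trans (e (thin i z))
                                                  (↭-reflexive (single-at-thin i τ z))))) ,
  ≤-trans (≤-reflexive (trans (size-⊢-resp-≈ d _) (trans s2 s1))) (n≤1+n _)
⊢-subst-var i w {W = W} {τ} x e b | inj₂ (y , refl , e2)
  with ⊩-↭ b (↭-trans (e i) (↭-reflexive (single-thin-gap i y τ)))
... | ⊩[] e' , _ =
  ⊢-≡ (sym e2) (⊢var λ z → ↭-trans (++⁺ (e (thin i z)) (e' z))
                             (↭-trans (++-identityʳ _) (↭-reflexive (single-thin i y z τ)))) ,
  ≤-trans (≤-reflexive (size-⊢-≡ (sym e2) _)) (s≤s z≤n)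

-- Types are not duplicated by substitution: w is typed once per occurrence of the
-- variable, so derivation sizes add up.
mutual
  ⊢-subst : ∀ i w {Δ W τ} t → (d : Δ ⊢ t ∶ τ) → (b : W ⊩ substAt i w i ∶ Δ i) →
    Σ ((Δ ∘ₑ thin i) ⊹ W ⊢ sub! (substAt i w) t ∶ τ) λ d' → size d' ≤ size d + size⊩ b
  ⊢-subst i w (var x) (⊢var e) b = ⊢-subst-var i w x e b
  ⊢-subst i w {W = W} (lam t) (⊢lam d e) b with ⊩-weaken-↭ b (↭-sym (e (suc i)))
  ... | b' , s' with ⊢-subst (suc i) w t d b'
  ... | d' , s = ⊢lam d' (⊹-pad-∷ₑ W (∘ₑ-ext (thin i) e)) , s≤s (subst (λ n → _ ≤ _ + n) s' s)
  ⊢-subst i w (app t u) (⊢app {Γ1 = Δ1} {Γ2 = Δ2} d f e) b with ⊩-split (Δ1 i) b (e i)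
  ... | W1 , W2 , b1 , b2 , eW , sW with ⊢-subst i w t d b1 | ⊢-subst i w u f b2
  ... | d' , s1 | f' , s2 =
    ⊢app d' f' (∘ₑ-⊹-interchange (thin i) Δ1 Δ2 W1 W2 e eW) ,
    s≤s (≤-+-interchange (size d) (size f) (size⊩ b1) (size⊩ b2) s1 s2 sW)
  ⊢-subst i w (es t u) (⊢es {Γ1 = Δ1} {Γ2 = Δ2} d e1 f e) b with ⊩-split (Δ1 i) b (e i)
  ... | W1 , W2 , b1 , b2 , eW , sW with ⊩-weaken-↭ b1 (↭-sym (e1 (suc i)))
  ... | b1' , s1' with ⊢-subst (suc i) w t d b1' | ⊢-subst i w u f b2
  ... | d' , s1 | f' , s2 =
    ⊢es d' (⊹-pad-∷ₑ W1 (∘ₑ-ext (thin i) e1)) f' (∘ₑ-⊹-interchange (thin i) Δ1 Δ2 W1 W2 e eW) ,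
    s≤s (≤-+-interchange (size d) (size f) (size⊩ b1) (size⊩ b2)
           (subst (λ n → _ ≤ _ + n) s1' s1) s2 sW)
  ⊢-subst i w (bang t) (⊢bang b₀) b with ⊩-subst i w t b₀ b
  ... | b' , s = ⊢bang b' , s≤s s
  ⊢-subst i w (der t) (⊢der d) b with ⊢-subst i w t d b
  ... | d' , s = ⊢der d' , s≤s s

  ⊩-subst : ∀ i w {Δ W M} t → (b₀ : Δ ⊩ t ∶ M) → (b : W ⊩ substAt i w i ∶ Δ i) →
    Σ ((Δ ∘ₑ thin i) ⊹ W ⊩ sub! (substAt i w) t ∶ M) λ b' → size⊩ b' ≤ size⊩ b₀ + size⊩ b
  ⊩-subst i w t (⊩[] e) b with ⊩-↭ b (e i)
  ... | ⊩[] e' , _ = ⊩[] (λ z → ++⁺ (e (thin i z)) (e' z)) , z≤n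
  ⊩-subst i w t (⊩∷ {Γ1 = Δ1} {Γ2 = Δ2} d b₀ e) b with ⊩-split (Δ1 i) b (e i)
  ... | W1 , W2 , b1 , b2 , eW , sW with ⊢-subst i w t d b1 | ⊩-subst i w t b₀ b2
  ... | d' , s1 | f' , s2 =
    ⊩∷ d' f' (∘ₑ-⊹-interchange (thin i) Δ1 Δ2 W1 W2 e eW) ,
    ≤-+-interchange (size d) (size⊩ b₀) (size⊩ b1) (size⊩ b2) s1 s2 sW

Unsubst : ℕ → Tm! → Env → (Env → Set) → Set
Unsubst i w Ξ J = Σ Env λ Δ → Σ Env λ W → J Δ × (W ⊩ substAt i w i ∶ Δ i) × (Ξ ≈ (Δ ∘ₑ thin i) ⊹ W)

⊢-unsubst-var : ∀ i w {Ξ τ} x → Ξ ⊢ substAt i w x ∶ τ → Unsubst i w Ξ (_⊢ var x ∶ τ)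
⊢-unsubst-var i w {Ξ} {τ} x d with substAt-view i w x
... | inj₁ refl =
  single i τ , Ξ , ⊢var ≈-refl , subst (Ξ ⊩ _ ∶_) (sym (single-self i τ)) (⊩-single d) ,
  (λ z → ↭-reflexive (cong (_++ Ξ z) (sym (single-at-thin i τ z))))
... | inj₂ (y , refl , e2) with ⊢-≡ e2 d
... | ⊢var e =
  single (thin i y) τ , ∅ , ⊢var ≈-refl , subst (∅ ⊩ _ ∶_) (sym (single-thin-gap i y τ)) (⊩[] ≈-refl) ,
  (λ z → ↭-trans (e z) (↭-trans (↭-reflexive (sym (single-thin i y z τ))) (↭-sym (++-identityʳ _))))

mutual
  ⊢-unsubst : ∀ i w {Ξ τ} t → Ξ ⊢ sub! (substAt i w) t ∶ τ → Unsubst i w Ξ (_⊢ t ∶ τ)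
  ⊢-unsubst i w (var x) d = ⊢-unsubst-var i w x d
  ⊢-unsubst i w (lam t) (⊢lam d e) with ⊢-unsubst (suc i) w t d
  ... | D , W , dt , bw , eq with ⊩-strengthen 0 (substAt i w i) bw
  ... | bw' , h =
    tl D , W ∘ₑ suc , ⊢lam dt (≈-∷ₑ-tl (↭-++-emptyʳ h (↭-trans (↭-sym (eq zero)) (e zero)))) , bw' ,
    ∷ₑ-≈-tl e eq
  ⊢-unsubst i w (app t u) (⊢app d f e) with ⊢-unsubst i w t d | ⊢-unsubst i w u f
  ... | D1 , W1 , dt , b1 , eq1 | D2 , W2 , du , b2 , eq2 =
    D1 ⊹ D2 , W1 ⊹ W2 , ⊢app dt du ≈-refl , ⊩-++ b1 b2 ,
    ≈-⊹-interchange (D1 ∘ₑ thin i) W1 (D2 ∘ₑ thin i) W2 e eq1 eq2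
  ⊢-unsubst i w (es t u) (⊢es d e1 f e) with ⊢-unsubst (suc i) w t d | ⊢-unsubst i w u f
  ... | D , W , dt , bw , eq | D2 , W2 , du , b2 , eq2 with ⊩-strengthen 0 (substAt i w i) bw
  ... | bw' , h =
    tl D ⊹ D2 , (W ∘ₑ suc) ⊹ W2 ,
    ⊢es dt (≈-∷ₑ-tl (↭-++-emptyʳ h (↭-trans (↭-sym (eq zero)) (e1 zero)))) du ≈-refl , ⊩-++ bw' b2 ,
    ≈-⊹-interchange (tl D ∘ₑ thin i) (W ∘ₑ suc) (D2 ∘ₑ thin i) W2 e
      (∷ₑ-≈-tl e1 eq) eq2
  ⊢-unsubst i w (bang t) (⊢bang b) with ⊩-unsubst i w t b
  ... | D , W , bt , bw , eq = D , W , ⊢bang bt , bw , eq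
  ⊢-unsubst i w (der t) (⊢der d) with ⊢-unsubst i w t d
  ... | D , W , dt , bw , eq = D , W , ⊢der dt , bw , eq

  ⊩-unsubst : ∀ i w {Ξ M} t → Ξ ⊩ sub! (substAt i w) t ∶ M → Unsubst i w Ξ (_⊩ t ∶ M)
  ⊩-unsubst i w t (⊩[] e) = ∅ , ∅ , ⊩[] ≈-refl , ⊩[] ≈-refl , e
  ⊩-unsubst i w t (⊩∷ d b e) with ⊢-unsubst i w t d | ⊩-unsubst i w t b
  ... | D1 , W1 , dt , b1 , eq1 | D2 , W2 , bt , b2 , eq2 =
    D1 ⊹ D2 , W1 ⊹ W2 , ⊩∷ dt bt ≈-refl , ⊩-++ b1 b2 ,
    ≈-⊹-interchange (D1 ∘ₑ thin i) W1 (D2 ∘ₑ thin i) W2 e eq1 eq2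

expand-dB : ∀ L t u {Γ τ} →
  Γ ⊢ plugL! L (es t (shift! (lenL! L) u)) ∶ τ → Γ ⊢ app (plugL! L (lam t)) u ∶ τ
expand-dB hole t u (⊢es dt e1 f e) = ⊢app (⊢lam dt e1) (⊢-≡ (shift!-zero u) f) e
expand-dB (L [ s ]) t u (⊢es {Γ2 = Γ2} d e1 ds e)
  with expand-dB L t (ren! suc u) (⊢-≡ (cong (λ z → plugL! L (es t z)) (shift!-suc (lenL! L) u)) d)
... | ⊢app {Γ1 = D1} {Γ2 = D2} dl fu eD with ⊢-strengthen 0 u fu
... | fu' , h =
  ⊢app (⊢es dl (≈-∷ₑ-tl (↭-++-emptyʳ h (↭-trans (↭-sym (eD zero)) (e1 zero)))) ds ≈-refl) fu'
       (≈-trans e (≈-trans (⊹-cong (∷ₑ-≈-tl e1 eD) ≈-refl)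
                           (⊹.xy∙z≈xz∙y (tl D1) (tl D2) Γ2)))

expand-s : ∀ t L u {Γ τ} →
  Γ ⊢ plugL! L (substUnder! (lenL! L) t u) ∶ τ → Γ ⊢ es t (plugL! L (bang u)) ∶ τ
expand-s t hole u d with ⊢-unsubst 0 u t (⊢-≡ (substUnder!-zero t u) d)
... | Δ , W , dt , bw , eq = ⊢es dt (≈-∷ₑ-tl ↭-refl) (⊢bang bw) eq
expand-s t (L [ s ]) u (⊢es {Γ2 = Γ2} {M = N} d e1 ds e)
  with expand-s (ren! (thin 1) t) L u (⊢-≡ (cong (plugL! L) (substUnder!-suc (lenL! L) t u)) d)
... | ⊢es {Γ1 = G1} {Γ2 = G2} dt e2 fx e3 with ⊢-strengthen 1 t dt
... | dt' , h =
  ⊢es dt' (∘ₑ-ext suc e2) (⊢es fx (≈-∷ₑ-tl G2₀↭N) ds ≈-refl)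
      (≈-trans e (≈-trans (⊹-cong (∷ₑ-≈-tl e1 e3) ≈-refl)
                          (⊹-assoc (tl G1) (tl G2) Γ2)))
  where
  G2₀↭N : G2 zero ↭ N
  G2₀↭N = ↭-++-emptyˡ (↭-trans (↭-sym (e2 (suc zero))) h) (↭-trans (↭-sym (e3 zero)) (e1 zero))

expand-d : ∀ L t {Γ τ} → Γ ⊢ plugL! L t ∶ τ → Γ ⊢ der (plugL! L (bang t)) ∶ τ
expand-d hole t d = ⊢der (⊢bang (⊩-single d))
expand-d (L [ s ]) t (⊢es d e1 ds e) with expand-d L t d
... | ⊢der d' = ⊢der (⊢es d' e1 ds e)

⊢-expand : ∀ {t t' Γ τ} → t →S t' → Γ ⊢ t' ∶ τ → Γ ⊢ t ∶ τ
⊢-expand (root (dB! L t u)) d = expand-dB L t u d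
⊢-expand (root (s! t L u)) d = expand-s t L u d
⊢-expand (root (d! L t)) d = expand-d L t d
⊢-expand (appL u r) (⊢app d f e) = ⊢app (⊢-expand r d) f e
⊢-expand (appR t r) (⊢app d f e) = ⊢app d (⊢-expand r f) e
⊢-expand (lamS r) (⊢lam d e) = ⊢lam (⊢-expand r d) e
⊢-expand (derS r) (⊢der d) = ⊢der (⊢-expand r d)
⊢-expand (esL u r) (⊢es d e1 f e) = ⊢es (⊢-expand r d) e1 f e
⊢-expand (esR t r) (⊢es d e1 f e) = ⊢es d e1 (⊢-expand r f) e

⊢-expand* : ∀ {t t' Γ τ} → t →S* t' → Γ ⊢ t' ∶ τ → Γ ⊢ t ∶ τ
⊢-expand* ε d = d
⊢-expand* (r ◅ rs) d = ⊢-expand r (⊢-expand* rs d)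

⊢-plugT!⁻ : ∀ T {Γ τ t} → Γ ⊢ plugT! T t ∶ τ → Σ Env λ Γ' → Σ Ty λ τ' → Γ' ⊢ t ∶ τ'
⊢-plugT!⁻ hole d = _ , _ , d
⊢-plugT!⁻ (appT T s) (⊢app d _ _) = ⊢-plugT!⁻ T d
⊢-plugT!⁻ (redexT T s) (⊢app (⊢lam d _) _ _) = ⊢-plugT!⁻ T d

Meaningful!⇒typable : ∀ t → Meaningful! t → Σ Env λ Γ → Σ Ty λ τ → Γ ⊢ t ∶ τ
Meaningful!⇒typable t (T , u , T⟨t⟩↠!u) =
  ⊢-plugT!⁻ T (⊢-expand* T⟨t⟩↠!u (⊢bang (⊩[] {t = u} ≈-refl)))

shrink-dB : ∀ L t u {Γ τ} (d : Γ ⊢ app (plugL! L (lam t)) u ∶ τ) →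
  Σ (Γ ⊢ plugL! L (es t (shift! (lenL! L) u)) ∶ τ) λ d' → size d' < size d
shrink-dB hole t u (⊢app (⊢lam dt e1) f e) =
  ⊢es dt e1 (⊢-≡ (sym (shift!-zero u)) f) e ,
  s≤s (s≤s (≤-reflexive (cong (size dt +_) (size-⊢-≡ (sym (shift!-zero u)) f))))
shrink-dB (L [ s ]) t u (⊢app {Γ2 = Γu} (⊢es {Γ1 = Γ1} {Γ2 = Γ2} dl e1 ds e') fu e)
  with ⊢-weaken 0 fu
... | fu' , sfu with shrink-dB L t (ren! suc u) (⊢app dl fu' ≈-refl)
... | d2 , lt =
  ⊢es (⊢-≡ e-shift d2) (⊹-pad-∷ₑ Γu e1) ds
      (≈-trans e (≈-trans (⊹-cong e' ≈-refl) (⊹.xy∙z≈xz∙y Γ1 Γ2 Γu))) ,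
  s≤s (begin-strict
    size (⊢-≡ e-shift d2) + size ds  ≡⟨ cong (_+ size ds) (size-⊢-≡ e-shift d2) ⟩
    size d2 + size ds                <⟨ +-monoˡ-< (size ds) (subst (λ n → size d2 < suc (size dl + n)) sfu lt) ⟩
    suc (size dl + size fu) + size ds ≡⟨ cong suc (ℕ+.xy∙z≈xz∙y (size dl) (size fu) (size ds)) ⟩
    suc (size dl + size ds) + size fu ∎)
  where
  open ≤-Reasoning
  e-shift : plugL! L (es t (shift! (lenL! L) (ren! suc u))) ≡ plugL! L (es t (shift! (suc (lenL! L)) u))
  e-shift = cong (λ z → plugL! L (es t z)) (sym (shift!-suc (lenL! L) u))

shrink-s : ∀ t u {Γ τ} (d : Γ ⊢ es t (bang u) ∶ τ) →
  Σ (Γ ⊢ sub! (substAt 0 u) t ∶ τ) λ d' → size d' < size d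
shrink-s t u (⊢es dt e1 (⊢bang b) e) with ⊩-↭ b (↭-sym (e1 zero))
... | b' , sb with ⊢-subst 0 u t dt b'
... | d' , sd =
  ⊢-resp-≈ d' (≈-sym (≈-trans e (⊹-cong (≈-sym (tl-cong e1)) ≈-refl))) ,
  s≤s (begin
    size (⊢-resp-≈ d' _)     ≡⟨ size-⊢-resp-≈ d' _ ⟩
    size d'                  ≤⟨ sd ⟩
    size dt + size⊩ b'       ≡⟨ cong (size dt +_) sb ⟩
    size dt + size⊩ b        ≤⟨ +-monoʳ-≤ (size dt) (n≤1+n _) ⟩
    size dt + suc (size⊩ b)  ∎)
  where open ≤-Reasoning

subject-reductionⁿ : ∀ {t t'} → t →n t' → ∀ {Γ τ} (d : Γ ⊢ t ⁿ ∶ τ) →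
  Σ (Γ ⊢ t' ⁿ ∶ τ) λ d' → size d' < size d
subject-reductionⁿ (root (dBn L t u)) d
  with shrink-dB (Lⁿ L) (t ⁿ) (bang (u ⁿ)) (⊢-≡ (ⁿ-dB-redex L t u) d)
... | d' , lt =
  ⊢-≡ (sym (ⁿ-dB-contractum L t u)) d' ,
  subst₂ _<_ (sym (size-⊢-≡ (sym (ⁿ-dB-contractum L t u)) d')) (size-⊢-≡ (ⁿ-dB-redex L t u) d) lt
subject-reductionⁿ (root (sn t u)) d with shrink-s (t ⁿ) (u ⁿ) d
... | d' , lt =
  ⊢-≡ (sym (ⁿ-subst0 t u)) d' , subst (_< size d) (sym (size-⊢-≡ (sym (ⁿ-subst0 t u)) d')) lt
subject-reductionⁿ (appL u r) (⊢app d f e) with subject-reductionⁿ r d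
... | d' , lt = ⊢app d' f e , s≤s (+-monoˡ-< (size f) lt)
subject-reductionⁿ (lamN r) (⊢lam d e) with subject-reductionⁿ r d
... | d' , lt = ⊢lam d' e , s≤s lt
subject-reductionⁿ (esL u r) (⊢es d e1 f e) with subject-reductionⁿ r d
... | d' , lt = ⊢es d' e1 f e , s≤s (+-monoˡ-< (size f) lt)

data Spine : Tmn → ℕ → ℕ → Set where
  var : ∀ x → Spine (var x) x 0
  app : ∀ {t x m} → Spine t x m → ∀ u → Spine (app t u) x (suc m)

data HNF : Tmn → ℕ → Set where
  spine : ∀ {t x m} → Spine t x m → HNF t 0
  lam : ∀ {t k} → HNF t k → HNF (lam t) (suc k)

hnf-or-step : ∀ t → Σ ℕ (HNF t) ⊎ Σ Tmn (t →n_)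
hnf-or-step (var x) = inj₁ (0 , spine (var x))
hnf-or-step (lam t) with hnf-or-step t
... | inj₁ (k , h) = inj₁ (suc k , lam h)
... | inj₂ (t' , r) = inj₂ (lam t' , lamN r)
hnf-or-step (app t u) with hnf-or-step t
... | inj₂ (t' , r) = inj₂ (app t' u , appL u r)
... | inj₁ (_ , spine sp) = inj₁ (0 , spine (app sp u))
hnf-or-step (app (lam t) u) | inj₁ (_ , lam h) = inj₂ (_ , root (dBn hole t u))
hnf-or-step (es t u) = inj₂ (_ , root (sn t u))

-- The size of the derivation bounds the number of head steps.
typableⁿ⇒hnf : ∀ t {Γ τ} → Γ ⊢ t ⁿ ∶ τ → Σ Tmn λ h → (t →n* h) × Σ ℕ (HNF h)
typableⁿ⇒hnf t d = go (size d) t d ≤-refl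
  where
  go : ∀ n t {Γ τ} (d : Γ ⊢ t ⁿ ∶ τ) → size d ≤ n → Σ Tmn λ h → (t →n* h) × Σ ℕ (HNF h)
  go n t d d≤n with hnf-or-step t
  ... | inj₁ hnf = t , ε , hnf
  ... | inj₂ (t' , r) with subject-reductionⁿ r d
  go zero t d d≤n | inj₂ (t' , r) | d' , d'<d with ≤-trans d'<d d≤n
  ... | ()
  go (suc n) t d d≤n | inj₂ (t' , r) | d' , d'<d with go n t' d' (≤-pred (≤-trans d'<d d≤n))
  ... | h , rs , hnf = h , r ◅ rs , hnf

plugTn-→n : ∀ T {t t'} → t →n t' → plugTn T t →n plugTn T t'
plugTn-→n hole r = r
plugTn-→n (appT T s) r = appL s (plugTn-→n T r)
plugTn-→n (redexT T s) r = appL s (lamN (plugTn-→n T r))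

_∘T_ : TCtxn → TCtxn → TCtxn
hole ∘T U = U
appT T s ∘T U = appT (T ∘T U) s
redexT T s ∘T U = redexT (T ∘T U) s

plugTn-∘T : ∀ T U t → plugTn (T ∘T U) t ≡ plugTn T (plugTn U t)
plugTn-∘T hole U t = refl
plugTn-∘T (appT T s) U t = cong (λ z → app z s) (plugTn-∘T T U t)
plugTn-∘T (redexT T s) U t = cong (λ z → app (lam z) s) (plugTn-∘T T U t)

Meaningfuln-expand : ∀ {t t'} → t →n* t' → Meaningfuln t' → Meaningfuln t
Meaningfuln-expand t↠t' (T , T⟨t'⟩↠id) = T , gmap (plugTn T) (plugTn-→n T) t↠t' ◅◅ T⟨t'⟩↠id

Meaningfuln-plugTn⁻ : ∀ U {t} → Meaningfuln (plugTn U t) → Meaningfuln t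
Meaningfuln-plugTn⁻ U {t} (T , T⟨U⟨t⟩⟩↠id) =
  T ∘T U , subst (_→n* idn) (sym (plugTn-∘T T U t)) T⟨U⟨t⟩⟩↠id

β-→n* : ∀ t s → app (lam t) s →n* subst0n t s
β-→n* t s = subst (λ z → app (lam t) s →n* subst0n t z) (renn-id (λ _ → refl) s)
  (root (dBn hole t s) ◅ root (sn t _) ◅ ε)

Meaningfuln-subst0⁻ : ∀ t s → Meaningfuln (subst0n t s) → Meaningfuln t
Meaningfuln-subst0⁻ t s m = Meaningfuln-plugTn⁻ (redexT hole s) (Meaningfuln-expand (β-→n* t s) m)

Meaningfuln-lam : ∀ t s → Meaningfuln (subst0n t s) → Meaningfuln (lam t)
Meaningfuln-lam t s m = Meaningfuln-plugTn⁻ (appT hole s) (Meaningfuln-expand (β-→n* t s) m)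

absorb : ℕ → Tmn
absorb zero = idn
absorb (suc m) = lam (absorb m)

absorb-closed : ∀ m σ → subn σ (absorb m) ≡ absorb m
absorb-closed zero σ = refl
absorb-closed (suc m) σ = cong lam (absorb-closed m (extsn σ))

Spine-subn : ∀ {t x m y} σ → Spine t x m → σ x ≡ var y → Spine (subn σ t) y m
Spine-subn {y = y} σ (var x) e = subst (λ z → Spine z y 0) (sym e) (var y)
Spine-subn σ (app sp u) e = app (Spine-subn σ sp e) (subn σ u)

HNF-subn : ∀ {t k} σ → HNF t k → (∀ z → Σ ℕ λ y → σ z ≡ var y) → HNF (subn σ t) k
HNF-subn σ (spine {x = x} sp) σ-var = spine (Spine-subn σ sp (proj₂ (σ-var x)))
HNF-subn σ (lam h) σ-var = lam (HNF-subn (extsn σ) h extsn-var)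
  where
  extsn-var : ∀ z → Σ ℕ λ y → extsn σ z ≡ var y
  extsn-var zero = zero , refl
  extsn-var (suc z) with σ-var z
  ... | y , e = suc y , cong (renn suc) e

Spine-absorb : ∀ {t m} σ k → Spine t 0 m → σ 0 ≡ absorb (m + k) → subn σ t →n* absorb k
Spine-absorb σ k (var 0) e = subst (_→n* absorb k) (sym e) ε
Spine-absorb {m = suc m} σ k (app sp u) e =
  gmap (λ a → app a (subn σ u)) (appL _)
       (Spine-absorb σ (suc k) sp (trans e (cong absorb (sym (+-suc m k)))))
  ◅◅ subst (app (lam (absorb k)) (subn σ u) →n*_) (absorb-closed k _) (β-→n* (absorb k) (subn σ u))

-- The head variable is moved to index 0 by substitutions x ↦ x − 1, then replaced by
-- absorb m, which eats the m arguments of the spine.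
Spine⇒Meaningfuln : ∀ x {t m} → Spine t x m → Meaningfuln t
Spine⇒Meaningfuln zero {t} {m} sp =
  Meaningfuln-subst0⁻ t (absorb m) (hole , Spine-absorb _ 0 sp (cong absorb (sym (+-identityʳ m))))
Spine⇒Meaningfuln (suc x) {t} sp =
  Meaningfuln-subst0⁻ t (var 0) (Spine⇒Meaningfuln x (Spine-subn _ sp refl))

HNF⇒Meaningfuln : ∀ k {t} → HNF t k → Meaningfuln t
HNF⇒Meaningfuln zero (spine {x = x} sp) = Spine⇒Meaningfuln x sp
HNF⇒Meaningfuln (suc k) (lam {t = t} h) =
  Meaningfuln-lam t (var 0) (HNF⇒Meaningfuln k (HNF-subn _ h subst0-var))
  where
  subst0-var : ∀ z → Σ ℕ λ y → subst0n (var z) (var 0) ≡ var y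
  subst0-var zero = zero , refl
  subst0-var (suc z) = z , refl

Meaningful!ⁿ⇒Meaningfuln : ∀ t → Meaningful! (t ⁿ) → Meaningfuln t
Meaningful!ⁿ⇒Meaningfuln t m with Meaningful!⇒typable (t ⁿ) m
... | _ , _ , d with typableⁿ⇒hnf t d
... | h , t↠h , k , hnf = Meaningfuln-expand t↠h (HNF⇒Meaningfuln k hnf)

theorem5p10 : (t : Tmn) → Meaningfuln t ⇔ Meaningful! (t ⁿ)
theorem5p10 t = mk⇔ (Meaningfuln⇒Meaningful!ⁿ t) (Meaningful!ⁿ⇒Meaningfuln t)
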